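{- Let $n \ge k \ge 2$ and let $X = (x_{i\,j}) \in \mathcal M_{n\,2}(\mathbb F)$. Then there exists $B \in \mathcal M_{n\,(k-2)}(\mathbb F)$ such that \[ \det_{n\, k} (X \mid B) = \begin{vmatrix} x_{1\, 1} & x_{1\, 2}\\ x_{2\, 1} & x_{2\, 2} \end{vmatrix} + \sum_{l = 3}^{n-k+2} (-1)^{l-2} \begin{vmatrix} x_{1\, 1} - x_{2\, 1}& x_{1\, 2} - x_{2\, 2}\\ x_{l\, 1} & x_{l\, 2} \end{vmatrix} + \sum_{2 < l < m \le n-k+2} (-1)^{l + m - 3} \begin{vmatrix} x_{l\, 1} & x_{l\, 2}\\ x_{m\, 1} & x_{m\, 2} \end{vmatrix}. \]
   Context: $\mathbb F$ is an arbitrary field and $\mathcal M_{n\,k}(\mathbb F)$ is the set of $n\times k$ matrices over $\mathbb F$; $x_{i\,j}$ denotes the entry of $X$ in row $i$ and column $j$. For $A \in \mathcal M_{n\,k_1}(\mathbb F)$ and $B \in \mathcal M_{n\,k_2}(\mathbb F)$, $A \mid B \in \mathcal M_{n\,(k_1+k_2)}(\mathbb F)$ is the block matrix $\begin{pmatrix} A & B\end{pmatrix}$. For $n \ge k$ and $X \in \mathcal M_{n\,k}(\mathbb F)$, the Cullis determinant is $\det_{n\,k}(X) = \sum_{c} \operatorname{sgn}(c)\det_k(X[c|))$, the sum over all $k$-element subsets $c=\{i_1<\dots<i_k\}\subseteq\{1,\dots,n\}$, where $X[c|)$ is the $k\times k$ submatrix of $X$ formed by the rows with indices in $c$ and $\operatorname{sgn}(c)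 = (-1)^{\sum_{\alpha=1}^k (i_\alpha - \alpha)}$; for $n=k$ it is the ordinary determinant. Vertical bars around a $2\times 2$ array denote the ordinary $2\times2$ determinant. When $k=2$, $B$ is the empty matrix and $X\mid B = X$. -}

module Defs where

open import Level using (_⊔_)
open import Algebra.Bundles using (CommutativeRing)
open import Data.Nat as ℕ using (ℕ; zero; suc; _∸_; _≤ᵇ_; _<ᵇ_)
open import Data.Bool using (Bool; true; false; if_then_else_; _∧_)
open import Data.Fin as Fin using (Fin; zero; suc; toℕ; punchIn)
open import Data.Vec as Vec using (Vec; []; _∷_; lookup)
open import Data.List as List using (List; []; _∷_; _++_)
open import Data.Product using (∃)
import Data.Sum
open import Relation.Nullary using (¬_)

record Field (c ℓ : Level.Level) : Set (Level.suc (c ⊔ ℓ)) where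
  field
    commutativeRing : CommutativeRing c ℓ
  open CommutativeRing commutativeRing public
  field
    0≉1     : ¬ (0# ≈ 1#)
    inverse : ∀ x → ¬ (x ≈ 0#) → ∃ λ y → (x * y) ≈ 1#

-- Matrices, determinants, Cullis determinant over a commutative ring.
-- Rows and columns are 0-indexed (Fin n); row i (0-based) is row i+1 of
-- the paper.

Matrix : ∀ {a} → Set a → ℕ → ℕ → Set a
Matrix A n k = Fin n → Fin k → A

module Cullis {c ℓ} (R : CommutativeRing c ℓ) where
  open CommutativeRing R hiding (zero)

  sgnPow : ℕ → Carrier
  sgnPow zero          = 1#
  sgnPow (suc zero)    = - 1#
  sgnPow (suc (suc e)) = sgnPow e

  Σ : ∀ {n} → (Fin n → Carrier) → Carrier
  Σ {zero}  f = 0#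
  Σ {suc n} f = f zero + Σ (λ i → f (suc i))

  Σˡ : ∀ {A : Set} → List A → (A → Carrier) → Carrier
  Σˡ []       f = 0#
  Σˡ (x ∷ xs) f = f x + Σˡ xs f

  det : ∀ n → Matrix Carrier n n → Carrier
  det zero    M = 1#
  det (suc n) M = Σ λ i → (sgnPow (toℕ i) * M i zero) *
                          det n (λ r s → M (punchIn i r) (suc s))

  -- k-element subsets of {0,…,n-1}, as strictly increasing vectors
  subsets : ∀ n k → List (Vec (Fin n) k)
  subsets n       zero    = [] ∷ []
  subsets zero    (suc k) = []
  subsets (suc n) (suc k) =
    List.map (λ v → zero ∷ Vec.map suc v) (subsets n k)
    ++ List.map (Vec.map suc) (subsets n (suc k))

  -- Σ_{α} (i_α - α)  (0-indexed, which gives the same number)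
  offset : ∀ {n k} → Vec (Fin n) k → ℕ → ℕ
  offset []       α = 0
  offset (i ∷ is) α = (toℕ i ∸ α) ℕ.+ offset is (suc α)

  sgn : ∀ {n k} → Vec (Fin n) k → Carrier
  sgn c = sgnPow (offset c 0)

  rows : ∀ {n k} → Matrix Carrier n k → Vec (Fin n) k → Matrix Carrier k k
  rows X c i j = X (lookup c i) j

  detC : ∀ n k → Matrix Carrier n k → Carrier
  detC n k X = Σˡ (subsets n k) λ c → sgn c * det k (rows X c)

  _∣_ : ∀ {n k₁ k₂} → Matrix Carrier n k₁ → Matrix Carrier n k₂ →
        Matrix Carrier n (k₁ ℕ.+ k₂)
  (A ∣ B) i j with Fin.splitAt _ j
  ... | Data.Sum.inj₁ j₁ = A i j₁
  ... | Data.Sum.inj₂ j₂ = B i j₂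

  det2 : Carrier → Carrier → Carrier → Carrier → Carrier
  det2 a b c d = a * d - b * c

  when : Bool → Carrier → Carrier
  when b x = if b then x else 0#

  -- Right-hand side of Lemma 17.  Paper (1-based) row l corresponds to
  -- Fin index l-1.  With L := n - k + 2:
  --   |x11 x12; x21 x22|
  --   + Σ_{l=3}^{L} (-1)^{l-2} |x11-x21 x12-x22; xl1 xl2|
  --   + Σ_{2<l<m≤L} (-1)^{l+m-3} |xl1 xl2; xm1 xm2|
  rhs : ∀ n k → Matrix Carrier n 2 → (r₁ r₂ : Fin n) → Carrier
  rhs n k X r₁ r₂ =
      det2 (x r₁ c₁) (x r₁ c₂) (x r₂ c₁) (x r₂ c₂)
    + Σ (λ l → when (inRange (L l))
          (sgnPow (L l ∸ 2) *
           det2 (x r₁ c₁ - x r₂ c₁) (x r₁ c₂ - x r₂ c₂) (x l c₁) (x l c₂)))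
    + Σ (λ l → Σ (λ m → when (inRange (L l) ∧ inRange (L m) ∧ (L l <ᵇ L m))
          (sgnPow (L l ℕ.+ L m ∸ 3) *
           det2 (x l c₁) (x l c₂) (x m c₁) (x m c₂))))
    where
      x = X
      c₁ : Fin 2
      c₁ = zero
      c₂ : Fin 2
      c₂ = suc zero
      L : Fin n → ℕ
      L l = suc (toℕ l)
      inRange : ℕ → Bool
      inRange l = (3 ≤ᵇ l) ∧ (l ≤ᵇ (n ∸ k) ℕ.+ 2)

module Submission where

-- Take for B the matrix with entries (-1)^(n-k) at the positions (n-k+2+j , j), a signed identity
-- in its last k-2 rows, and 0 elsewhere.  The Cullis determinant obeys Laplace's expansion along the
-- first column, so expanding det_{n k}(X | B) along the two columns of X leaves, for each pair of
-- rows l, m used by X, the Cullis determinant of B without these rows.  It vanishes (a column of B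
-- has become zero) unless l and m lie among the first q = n-k+2 rows; then it is a diagonal
-- determinant each of whose Laplace steps contributes (-1)^(n-k) · (-1)^(n-k) = 1.  So det_{n k}(X | B)
-- is the Cullis determinant of X with its rows below q erased, the sum over pairs l < m ≤ q of
-- (-1)^(l+m-3) |x_l ; x_m|; grouping the pairs that meet rows 1 and 2 gives the formula.

open import Defs
open import Data.Nat as ℕ using (ℕ; _≤_; _∸_; z≤n; s≤s)
open import Data.Nat.Properties using (≤-trans)
open import Data.Fin using (fromℕ<)
open import Data.Product using (∃)

open import Algebra.Bundles using (CommutativeRing)
open import Data.Bool using (Bool; true; false; _∧_)
open import Data.Bool.Properties using (∧-zeroʳ)
open import Data.Fin as Fin using (Fin; zero; suc; toℕ; punchIn)
open import Data.Fin.Patterns using (0F; 1F)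
import Data.Fin.Properties as Fin
open import Data.List as List using (List; []; _∷_; _++_)
open import Data.List.Relation.Unary.All as All using (All; []; _∷_)
import Data.List.Relation.Unary.All.Properties as All
open import Data.Nat using (zero; suc; _<_)
import Data.Nat.Properties as ℕ
open import Data.Product using (_×_; _,_)
open import Data.Unit using (⊤; tt)
open import Data.Vec as Vec using (Vec; []; _∷_; lookup; removeAt)
import Data.Vec.Properties as Vec
open import Function using (_∘_; _⇔_; mk⇔; Equivalence)
open import Relation.Binary.PropositionalEquality as ≡ using (_≡_; _≢_)
open import Relation.Nullary using (Dec; does; yes; no; ¬_; contradiction)
open import Relation.Nullary.Decidable using (dec-true; dec-false; does-⇔)

import Algebra.Properties.CommutativeSemigroup ℕ.+-commutativeSemigroup as ℕ-+

module CullisProperties {c ℓ} (R : CommutativeRing c ℓ) where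

  open CommutativeRing R hiding (zero)
  open Cullis R
  open import Algebra.Properties.Ring ring
  import Algebra.Properties.CommutativeSemigroup +-commutativeSemigroup as +-CS
  import Algebra.Properties.CommutativeSemigroup *-commutativeSemigroup as *-CS
  open import Relation.Binary.Reasoning.Setoid setoid

  Σ-cong : ∀ {n} {f g : Fin n → Carrier} → (∀ i → f i ≈ g i) → Σ f ≈ Σ g
  Σ-cong {zero}  f≈g = refl
  Σ-cong {suc n} f≈g = +-cong (f≈g zero) (Σ-cong (λ i → f≈g (suc i)))

  Σ-zero : ∀ {n} {f : Fin n → Carrier} → (∀ i → f i ≈ 0#) → Σ f ≈ 0#
  Σ-zero {zero}  f≈0 = refl
  Σ-zero {suc n} f≈0 = trans (+-cong (f≈0 zero) (Σ-zero (λ i → f≈0 (suc i)))) (+-identityˡ 0#)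

  Σ-+ : ∀ {n} (f g : Fin n → Carrier) → Σ (λ i → f i + g i) ≈ Σ f + Σ g
  Σ-+ {zero}  f g = sym (+-identityˡ 0#)
  Σ-+ {suc n} f g = trans (+-congˡ (Σ-+ (λ i → f (suc i)) (λ i → g (suc i)))) (+-CS.interchange _ _ _ _)

  *-distribˡ-Σ : ∀ {n} x (f : Fin n → Carrier) → x * Σ f ≈ Σ (λ i → x * f i)
  *-distribˡ-Σ {zero}  x f = zeroʳ x
  *-distribˡ-Σ {suc n} x f = trans (distribˡ x _ _) (+-congˡ (*-distribˡ-Σ x (λ i → f (suc i))))

  -‿Σ : ∀ {n} (f : Fin n → Carrier) → - Σ f ≈ Σ (λ i → - f i)
  -‿Σ {zero}  f = -0#≈0#
  -‿Σ {suc n} f = trans (sym (-‿+-comm _ _)) (+-congˡ (-‿Σ (λ i → f (suc i))))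

  Σ-single : ∀ {n} (f : Fin n → Carrier) p → (∀ i → i ≢ p → f i ≈ 0#) → Σ f ≈ f p
  Σ-single f zero    f≈0 = trans (+-congˡ (Σ-zero (λ i → f≈0 (suc i) λ ()))) (+-identityʳ _)
  Σ-single f (suc p) f≈0 =
    trans (+-cong (f≈0 zero λ ()) (Σ-single (λ i → f (suc i)) p (λ i i≢p → f≈0 (suc i) (i≢p ∘ Fin.suc-injective))))
          (+-identityˡ _)

  Σˡ-cong : ∀ {A : Set} (xs : List A) {f g : A → Carrier} → (∀ x → f x ≈ g x) → Σˡ xs f ≈ Σˡ xs g
  Σˡ-cong []       f≈g = refl
  Σˡ-cong (x ∷ xs) f≈g = +-cong (f≈g x) (Σˡ-cong xs f≈g)

  Σˡ-cong-All : ∀ {A : Set} {P : A → Set} {xs : List A} {f g : A → Carrier} →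
                All P xs → (∀ x → P x → f x ≈ g x) → Σˡ xs f ≈ Σˡ xs g
  Σˡ-cong-All []         f≈g = refl
  Σˡ-cong-All (px ∷ pxs) f≈g = +-cong (f≈g _ px) (Σˡ-cong-All pxs f≈g)

  Σˡ-++ : ∀ {A : Set} (xs ys : List A) (f : A → Carrier) → Σˡ (xs ++ ys) f ≈ Σˡ xs f + Σˡ ys f
  Σˡ-++ []       ys f = sym (+-identityˡ _)
  Σˡ-++ (x ∷ xs) ys f = trans (+-congˡ (Σˡ-++ xs ys f)) (sym (+-assoc _ _ _))

  Σˡ-map : ∀ {A B : Set} (g : A → B) (xs : List A) (f : B → Carrier) →
           Σˡ (List.map g xs) f ≡ Σˡ xs (f ∘ g)
  Σˡ-map g []       f = ≡.refl
  Σˡ-map g (x ∷ xs) f = ≡.cong (f (g x) +_) (Σˡ-map g xs f)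

  *-distribˡ-Σˡ : ∀ {A : Set} x (xs : List A) (f : A → Carrier) → x * Σˡ xs f ≈ Σˡ xs (λ a → x * f a)
  *-distribˡ-Σˡ x []       f = zeroʳ x
  *-distribˡ-Σˡ x (a ∷ xs) f = trans (distribˡ x _ _) (+-congˡ (*-distribˡ-Σˡ x xs f))

  Σˡ-+ : ∀ {A : Set} (xs : List A) (f g : A → Carrier) → Σˡ xs (λ a → f a + g a) ≈ Σˡ xs f + Σˡ xs g
  Σˡ-+ []       f g = sym (+-identityˡ 0#)
  Σˡ-+ (a ∷ xs) f g = trans (+-congˡ (Σˡ-+ xs f g)) (+-CS.interchange _ _ _ _)

  -‿Σˡ : ∀ {A : Set} (xs : List A) (f : A → Carrier) → - Σˡ xs f ≈ Σˡ xs (λ a → - f a)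
  -‿Σˡ []       f = -0#≈0#
  -‿Σˡ (a ∷ xs) f = trans (sym (-‿+-comm _ _)) (+-congˡ (-‿Σˡ xs f))

  sgnPow-suc : ∀ e → sgnPow (suc e) ≈ - sgnPow e
  sgnPow-suc zero          = refl
  sgnPow-suc (suc zero)    = sym (-‿involutive 1#)
  sgnPow-suc (suc (suc e)) = sgnPow-suc e

  sgnPow-+ : ∀ d e → sgnPow (d ℕ.+ e) ≈ sgnPow d * sgnPow e
  sgnPow-+ zero          e = sym (*-identityˡ _)
  sgnPow-+ (suc zero)    e = trans (sgnPow-suc e) (sym (-1*x≈-x _))
  sgnPow-+ (suc (suc d)) e = sgnPow-+ d e

  sgnPow-square : ∀ e → sgnPow e * sgnPow e ≈ 1#
  sgnPow-square zero          = *-identityˡ 1#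
  sgnPow-square (suc zero)    = trans (-1*x≈-x (- 1#)) (-‿involutive 1#)
  sgnPow-square (suc (suc e)) = sgnPow-square e

  -x*[y-z]≈-xy+xz : ∀ x y z → - x * (y - z) ≈ - (x * y) + x * z
  -x*[y-z]≈-xy+xz x y z = begin
    - x * (y - z)            ≈⟨ x[y-z]≈xy-xz (- x) y z ⟩
    - x * y - - x * z        ≈⟨ +-cong (-‿distribˡ-* x y) (-‿cong (-‿distribˡ-* x z)) ⟨
    - (x * y) - - (x * z)    ≈⟨ +-congˡ (-‿involutive (x * z)) ⟩
    - (x * y) + x * z        ∎

  when-holds : ∀ {P : Set} (p? : Dec P) → P → ∀ x → when (does p?) x ≡ x
  when-holds p? p x = ≡.cong (λ b → when b x) (dec-true p? p)

  when-fails : ∀ {P : Set} (p? : Dec P) → ¬ P → ∀ x → when (does p?) x ≡ 0#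
  when-fails p? ¬p x = ≡.cong (λ b → when b x) (dec-false p? ¬p)

  when-cong : ∀ b {x y} → x ≈ y → when b x ≈ when b y
  when-cong true  x≈y = x≈y
  when-cong false x≈y = refl

  when-+ : ∀ b x y → when b x + when b y ≈ when b (x + y)
  when-+ true  x y = refl
  when-+ false x y = +-identityˡ 0#

  det2-zero : ∀ a b → det2 a b 0# 0# ≈ 0#
  det2-zero a b = trans (+-cong (zeroʳ a) (-‿cong (zeroʳ b))) (trans (+-identityˡ _) -0#≈0#)

  det2-sub : ∀ a b c d e f → det2 (a - b) (c - d) e f ≈ det2 a c e f - det2 b d e f
  det2-sub a b c d e f = begin
    (a - b) * f - (c - d) * e              ≈⟨ +-cong ([y-z]x≈yx-zx f a b) (-‿cong ([y-z]x≈yx-zx e c d)) ⟩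
    (a * f - b * f) - (c * e - d * e)      ≈⟨ +-congˡ -[x-y]≈-x+y ⟩
    (a * f - b * f) + (- (c * e) + d * e)  ≈⟨ +-CS.interchange _ _ _ _ ⟩
    (a * f - c * e) + (- (b * f) + d * e)  ≈⟨ +-congˡ -[x-y]≈-x+y ⟨
    (a * f - c * e) - (b * f - d * e)      ∎
    where
    -[x-y]≈-x+y : ∀ {x y} → - (x - y) ≈ - x + y
    -[x-y]≈-x+y {x} {y} = trans (sym (-‿+-comm x (- y))) (+-congˡ (-‿involutive y))

  removeAt-suc : ∀ {A : Set} {k} (x : A) (xs : Vec A (suc k)) i → removeAt (x ∷ xs) (suc i) ≡ x ∷ removeAt xs i
  removeAt-suc x (y ∷ xs) i = ≡.refl

  removeAt-map : ∀ {A B : Set} {k} (f : A → B) (v : Vec A (suc k)) i →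
                 removeAt (Vec.map f v) i ≡ Vec.map f (removeAt v i)
  removeAt-map f (x ∷ xs)     zero    = ≡.refl
  removeAt-map f (x ∷ y ∷ xs) (suc i) = ≡.cong (f x ∷_) (removeAt-map f (y ∷ xs) i)

  lookup-removeAt : ∀ {A : Set} {k} (v : Vec A (suc k)) i j → lookup (removeAt v i) j ≡ lookup v (punchIn i j)
  lookup-removeAt v i j = ≡.trans (≡.sym (Vec.insertAt-punchIn (removeAt v i) i (lookup v i) j))
                                  (≡.cong (λ w → lookup w (punchIn i j)) (Vec.insertAt-removeAt v i))

  map-punchIn-suc : ∀ {n k} (r : Fin (suc n)) (u : Vec (Fin n) k) →
                    Vec.map (punchIn (suc r)) (Vec.map suc u) ≡ Vec.map suc (Vec.map (punchIn r) u)
  map-punchIn-suc r u = ≡.trans (≡.sym (Vec.map-∘ (punchIn (suc r)) suc u)) (Vec.map-∘ suc (punchIn r) u)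

  toℕ-punchIn-< : ∀ {N} (r : Fin (suc N)) (a : Fin N) → toℕ a < toℕ r → toℕ (punchIn r a) ≡ toℕ a
  toℕ-punchIn-< (suc r) zero    _         = ≡.refl
  toℕ-punchIn-< (suc r) (suc a) (s≤s a<r) = ≡.cong suc (toℕ-punchIn-< r a a<r)

  toℕ-punchIn-≥ : ∀ {N} (r : Fin (suc N)) (a : Fin N) → toℕ r ≤ toℕ a → toℕ (punchIn r a) ≡ suc (toℕ a)
  toℕ-punchIn-≥ zero    a       _         = ≡.refl
  toℕ-punchIn-≥ (suc r) (suc a) (s≤s r≤a) = ≡.cong suc (toℕ-punchIn-≥ r a r≤a)

  punchIn≡suc⇔ : ∀ {N t} (r : Fin (suc N)) (a : Fin N) → toℕ r ≤ t → toℕ (punchIn r a) ≡ suc t ⇔ toℕ a ≡ t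
  punchIn≡suc⇔ r a r≤t with toℕ a ℕ.<? toℕ r
  ... | yes a<r = mk⇔ (λ e → contradiction (≡.subst (_< toℕ r) (≡.trans (≡.sym (toℕ-punchIn-< r a a<r)) e) a<r)
                                           (ℕ.≤⇒≯ r≤t ∘ ℕ.<-trans (ℕ.n<1+n _)))
                      (λ e → contradiction (≡.subst (_< toℕ r) e a<r) (ℕ.≤⇒≯ r≤t))
  ... | no a≮r  = mk⇔ (λ e → ℕ.suc-injective (≡.trans (≡.sym (toℕ-punchIn-≥ r a (ℕ.≮⇒≥ a≮r))) e))
                      (λ e → ≡.trans (toℕ-punchIn-≥ r a (ℕ.≮⇒≥ a≮r)) (≡.cong suc e))

  punchIn<suc⇔ : ∀ {N t} (r : Fin (suc N)) (a : Fin N) → toℕ r ≤ t → toℕ (punchIn r a) < suc t ⇔ toℕ a < t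
  punchIn<suc⇔ r a r≤t with toℕ a ℕ.<? toℕ r
  ... | yes a<r = mk⇔ (λ _ → ℕ.<-≤-trans a<r r≤t)
                      (λ _ → ≡.subst (_< suc _) (≡.sym (toℕ-punchIn-< r a a<r)) (ℕ.<-≤-trans a<r (ℕ.m≤n⇒m≤1+n r≤t)))
  ... | no a≮r  = mk⇔ (λ p → ℕ.≤-pred (≡.subst (_< suc _) (toℕ-punchIn-≥ r a (ℕ.≮⇒≥ a≮r)) p))
                      (λ a<t → ≡.subst (_< suc _) (≡.sym (toℕ-punchIn-≥ r a (ℕ.≮⇒≥ a≮r))) (s≤s a<t))

  -- Cullis's Laplace expansion

  -- The j-th entry of v is at least α + j.  Members of `subsets` satisfy this with α = 0,
  -- which keeps the truncated subtraction in `offset` exact.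
  Above : ∀ {n k} → ℕ → Vec (Fin n) k → Set
  Above α []       = ⊤
  Above α (i ∷ is) = α ≤ toℕ i × Above (suc α) is

  Above-map-suc : ∀ {n k α} (v : Vec (Fin n) k) → Above α v → Above (suc α) (Vec.map suc v)
  Above-map-suc []       _         = tt
  Above-map-suc (i ∷ is) (α≤i , a) = s≤s α≤i , Above-map-suc is a

  Above-pred : ∀ {n k α} (v : Vec (Fin n) k) → Above (suc α) v → Above α v
  Above-pred []       _         = tt
  Above-pred (i ∷ is) (α<i , a) = ℕ.<⇒≤ α<i , Above-pred is a

  subsets-Above : ∀ n k → All (Above 0) (subsets n k)
  subsets-Above n       zero    = tt ∷ []
  subsets-Above zero    (suc k) = []
  subsets-Above (suc n) (suc k) =
    All.++⁺ (All.map⁺ (All.map (λ {v} a → z≤n , Above-map-suc v a) (subsets-Above n k)))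
            (All.map⁺ (All.map (λ {v} a → Above-pred (Vec.map suc v) (Above-map-suc v a)) (subsets-Above n (suc k))))

  offset-map-suc-suc : ∀ {n k} (v : Vec (Fin n) k) α → offset (Vec.map suc v) (suc α) ≡ offset v α
  offset-map-suc-suc []       α = ≡.refl
  offset-map-suc-suc (i ∷ is) α = ≡.cong (toℕ i ∸ α ℕ.+_) (offset-map-suc-suc is (suc α))

  offset-map-suc : ∀ {n k α} (v : Vec (Fin n) k) → Above α v → offset (Vec.map suc v) α ≡ k ℕ.+ offset v α
  offset-map-suc []       _         = ≡.refl
  offset-map-suc {k = suc k} {α} (i ∷ is) (α≤i , a) =
    ≡.trans (≡.cong₂ ℕ._+_ (ℕ.+-∸-assoc 1 α≤i) (offset-map-suc is a))
            (≡.cong suc (ℕ-+.x∙yz≈y∙xz (toℕ i ∸ α) k (offset is (suc α))))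

  sgn-zero∷ : ∀ {n k} (v : Vec (Fin n) k) → sgn (zero ∷ Vec.map suc v) ≡ sgn v
  sgn-zero∷ v = ≡.cong sgnPow (offset-map-suc-suc v 0)

  sgn-map-suc : ∀ {n k} (v : Vec (Fin n) k) → Above 0 v → sgn (Vec.map suc v) ≈ sgnPow k * sgn v
  sgn-map-suc {k = k} v a = trans (reflexive (≡.cong sgnPow (offset-map-suc v a))) (sgnPow-+ k _)

  Σˡ-subsets-suc : ∀ n k (f : Vec (Fin (suc n)) (suc k) → Carrier) →
                   Σˡ (subsets (suc n) (suc k)) f
                     ≈ Σˡ (subsets n k) (f ∘ (zero ∷_) ∘ Vec.map suc) + Σˡ (subsets n (suc k)) (f ∘ Vec.map suc)
  Σˡ-subsets-suc n k f = trans (Σˡ-++ (List.map _ (subsets n k)) _ f)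
                               (reflexive (≡.cong₂ _+_ (Σˡ-map _ (subsets n k) f) (Σˡ-map _ (subsets n (suc k)) f)))

  Σˡ-sgn-map-suc : ∀ n k (h : Vec (Fin n) k → Carrier) →
                   Σˡ (subsets n k) (λ v → sgn (Vec.map suc v) * h v) ≈ sgnPow k * Σˡ (subsets n k) (λ v → sgn v * h v)
  Σˡ-sgn-map-suc n k h = trans (Σˡ-cong-All (subsets-Above n k) (λ v a → trans (*-congʳ (sgn-map-suc v a)) (*-assoc _ _ _)))
                               (sym (*-distribˡ-Σˡ _ (subsets n k) _))

  -- A first-column expansion over the rows c, with the cofactor of row r (the remaining
  -- rows being w) abstracted to G r w.
  expansion : ∀ {N k} → (Fin N → Vec (Fin N) k → Carrier) → Vec (Fin N) (suc k) → Carrier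
  expansion G c = Σ λ i → sgnPow (toℕ i) * G (lookup c i) (removeAt c i)

  shift : ∀ {N k} → (Fin (suc N) → Vec (Fin (suc N)) k → Carrier) → Fin N → Vec (Fin N) k → Carrier
  shift G a w = G (suc a) (Vec.map suc w)

  shift₀ : ∀ {N k} → (Fin (suc N) → Vec (Fin (suc N)) (suc k) → Carrier) → Fin N → Vec (Fin N) k → Carrier
  shift₀ G a w = G (suc a) (zero ∷ Vec.map suc w)

  expansion-map-suc : ∀ {N k} G (v : Vec (Fin N) (suc k)) → expansion G (Vec.map suc v) ≈ expansion (shift G) v
  expansion-map-suc G v = Σ-cong λ i →
    *-congˡ {sgnPow (toℕ i)} (reflexive (≡.cong₂ G (Vec.lookup-map i suc v) (removeAt-map suc v i)))

  expansion-zero∷ : ∀ {N k} G (v : Vec (Fin N) (suc k)) →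
                    expansion G (zero ∷ Vec.map suc v) ≈ G zero (Vec.map suc v) - expansion (shift₀ G) v
  expansion-zero∷ G v = +-cong (*-identityˡ _) (begin
    Σ (λ i → sgnPow (suc (toℕ i)) * G (lookup (Vec.map suc v) i) (removeAt (zero ∷ Vec.map suc v) (suc i)))
      ≈⟨ Σ-cong (λ i → *-cong (sgnPow-suc (toℕ i)) (reflexive (≡.cong₂ G (Vec.lookup-map i suc v)
            (≡.trans (removeAt-suc zero (Vec.map suc v) i) (≡.cong (zero ∷_) (removeAt-map suc v i)))))) ⟩
    Σ (λ i → - sgnPow (toℕ i) * shift₀ G (lookup v i) (removeAt v i))
      ≈⟨ Σ-cong (λ i → sym (-‿distribˡ-* (sgnPow (toℕ i)) (shift₀ G (lookup v i) (removeAt v i)))) ⟩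
    Σ (λ i → - (sgnPow (toℕ i) * shift₀ G (lookup v i) (removeAt v i)))
      ≈⟨ -‿Σ (λ i → sgnPow (toℕ i) * shift₀ G (lookup v i) (removeAt v i)) ⟨
    - expansion (shift₀ G) v ∎)

  subsetExpansion : ∀ n k → (Fin n → Vec (Fin n) k → Carrier) → Carrier
  subsetExpansion n k G = Σˡ (subsets n (suc k)) λ c → sgn c * expansion G c

  rowExpansion : ∀ n k → (Fin (suc n) → Vec (Fin (suc n)) k → Carrier) → Carrier
  rowExpansion n k G = Σ λ r → sgnPow (toℕ r) * Σˡ (subsets n k) λ w → sgn w * G r (Vec.map (punchIn r) w)

  -- Regrouping by the row r = cᵢ used in the first column turns (c , i) into (r , w) with
  -- sgn c · (-1)^i = (-1)^r · sgn w; the induction follows the recursion of `subsets`.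
  subsetExpansion≈rowExpansion : ∀ n k G → subsetExpansion (suc n) k G ≈ rowExpansion n k G
  subsetExpansion≈rowExpansion zero    zero    G = refl
  subsetExpansion≈rowExpansion zero    (suc k) G = sym (trans (+-identityʳ _) (zeroʳ _))
  subsetExpansion≈rowExpansion (suc n) zero    G =
    trans (Σˡ-subsets-suc (suc n) zero _) (+-cong (+-identityʳ _) (begin
    Σˡ (subsets (suc n) 1) (λ v → sgn (Vec.map suc v) * expansion G (Vec.map suc v))
      ≈⟨ Σˡ-cong (subsets (suc n) 1) (λ v → *-congˡ (expansion-map-suc G v)) ⟩
    Σˡ (subsets (suc n) 1) (λ v → sgn (Vec.map suc v) * expansion (shift G) v)
      ≈⟨ Σˡ-sgn-map-suc (suc n) 1 (expansion (shift G)) ⟩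
    - 1# * subsetExpansion (suc n) zero (shift G)
      ≈⟨ *-congˡ (subsetExpansion≈rowExpansion n zero (shift G)) ⟩
    - 1# * rowExpansion n zero (shift G)
      ≈⟨ *-distribˡ-Σ (- 1#) (λ r → sgnPow (toℕ r) * T r) ⟩
    Σ (λ r → - 1# * (sgnPow (toℕ r) * T r))
      ≈⟨ Σ-cong (λ r → trans (sym (*-assoc _ _ (T r))) (*-congʳ (sym (sgnPow-+ 1 (toℕ r))))) ⟩
    Σ (λ r → sgnPow (suc (toℕ r)) * T r) ∎))
    where
    T : Fin (suc n) → Carrier
    T r = Σˡ (subsets n zero) (λ w → sgn w * shift G r (Vec.map (punchIn r) w))
  subsetExpansion≈rowExpansion (suc n) (suc k) G = begin
    subsetExpansion (suc (suc n)) (suc k) G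
      ≈⟨ Σˡ-subsets-suc (suc n) (suc k) _ ⟩
    Σˡ S (λ v → sgn (zero ∷ Vec.map suc v) * expansion G (zero ∷ Vec.map suc v))
      + Σˡ S′ (λ v → sgn (Vec.map suc v) * expansion G (Vec.map suc v))
      ≈⟨ +-cong headTerms tailTerms ⟩
    (Σˡ S (λ w → sgn w * G zero (Vec.map suc w)) - rowExpansion n k (shift₀ G))
      + sgnPow k * rowExpansion n (suc k) (shift G)
      ≈⟨ +-assoc _ _ _ ⟩
    Σˡ S (λ w → sgn w * G zero (Vec.map suc w))
      + (- rowExpansion n k (shift₀ G) + sgnPow k * rowExpansion n (suc k) (shift G))
      ≈⟨ +-cong (sym (*-identityˡ _)) laterRows ⟩
    rowExpansion (suc n) (suc k) G ∎
    where
    S = subsets (suc n) (suc k)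
    S′ = subsets (suc n) (suc (suc k))
    P Q : Fin (suc n) → Carrier
    P r = Σˡ (subsets n k) (λ u → sgn u * shift₀ G r (Vec.map (punchIn r) u))
    Q r = Σˡ (subsets n (suc k)) (λ u → sgn u * shift G r (Vec.map (punchIn r) u))

    headTerms : Σˡ S (λ v → sgn (zero ∷ Vec.map suc v) * expansion G (zero ∷ Vec.map suc v))
                  ≈ Σˡ S (λ w → sgn w * G zero (Vec.map suc w)) - rowExpansion n k (shift₀ G)
    headTerms = begin
      Σˡ S (λ v → sgn (zero ∷ Vec.map suc v) * expansion G (zero ∷ Vec.map suc v))
        ≈⟨ Σˡ-cong S (λ v → trans (*-cong (reflexive (sgn-zero∷ v)) (expansion-zero∷ G v)) (x[y-z]≈xy-xz _ _ _)) ⟩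
      Σˡ S (λ v → sgn v * G zero (Vec.map suc v) - sgn v * expansion (shift₀ G) v)
        ≈⟨ Σˡ-+ S _ _ ⟩
      Σˡ S (λ v → sgn v * G zero (Vec.map suc v)) + Σˡ S (λ v → - (sgn v * expansion (shift₀ G) v))
        ≈⟨ +-congˡ (-‿Σˡ S _) ⟨
      Σˡ S (λ v → sgn v * G zero (Vec.map suc v)) - subsetExpansion (suc n) k (shift₀ G)
        ≈⟨ +-congˡ (-‿cong (subsetExpansion≈rowExpansion n k (shift₀ G))) ⟩
      Σˡ S (λ w → sgn w * G zero (Vec.map suc w)) - rowExpansion n k (shift₀ G) ∎

    tailTerms : Σˡ S′ (λ v → sgn (Vec.map suc v) * expansion G (Vec.map suc v))
                  ≈ sgnPow k * rowExpansion n (suc k) (shift G)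
    tailTerms = begin
      Σˡ S′ (λ v → sgn (Vec.map suc v) * expansion G (Vec.map suc v))
        ≈⟨ Σˡ-cong S′ (λ v → *-congˡ (expansion-map-suc G v)) ⟩
      Σˡ S′ (λ v → sgn (Vec.map suc v) * expansion (shift G) v)
        ≈⟨ Σˡ-sgn-map-suc (suc n) (suc (suc k)) (expansion (shift G)) ⟩
      sgnPow k * subsetExpansion (suc n) (suc k) (shift G)
        ≈⟨ *-congˡ (subsetExpansion≈rowExpansion n (suc k) (shift G)) ⟩
      sgnPow k * rowExpansion n (suc k) (shift G) ∎

    cofactors : ∀ r → Σˡ S (λ w → sgn w * G (suc r) (Vec.map (punchIn (suc r)) w)) ≈ P r - sgnPow k * Q r
    cofactors r = begin
      Σˡ S (λ w → sgn w * G (suc r) (Vec.map (punchIn (suc r)) w))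
        ≈⟨ Σˡ-subsets-suc n k _ ⟩
      Σˡ (subsets n k) (λ u → sgn (zero ∷ Vec.map suc u) * G (suc r) (zero ∷ Vec.map (punchIn (suc r)) (Vec.map suc u)))
        + Σˡ (subsets n (suc k)) (λ u → sgn (Vec.map suc u) * G (suc r) (Vec.map (punchIn (suc r)) (Vec.map suc u)))
        ≈⟨ +-cong (Σˡ-cong (subsets n k) (λ u → reflexive (≡.cong₂ _*_ (sgn-zero∷ u)
                                                 (≡.cong (λ w → G (suc r) (zero ∷ w)) (map-punchIn-suc r u)))))
                  (Σˡ-cong (subsets n (suc k)) (λ u → *-congˡ (reflexive (≡.cong (G (suc r)) (map-punchIn-suc r u))))) ⟩
      P r + Σˡ (subsets n (suc k)) (λ u → sgn (Vec.map suc u) * shift G r (Vec.map (punchIn r) u))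
        ≈⟨ +-congˡ (Σˡ-sgn-map-suc n (suc k) _) ⟩
      P r + sgnPow (suc k) * Q r
        ≈⟨ +-congˡ (trans (*-congʳ (sgnPow-suc k)) (sym (-‿distribˡ-* _ _))) ⟩
      P r - sgnPow k * Q r ∎

    laterRows : - rowExpansion n k (shift₀ G) + sgnPow k * rowExpansion n (suc k) (shift G)
                  ≈ Σ (λ r → sgnPow (suc (toℕ r)) * Σˡ S (λ w → sgn w * G (suc r) (Vec.map (punchIn (suc r)) w)))
    laterRows = begin
      - rowExpansion n k (shift₀ G) + sgnPow k * rowExpansion n (suc k) (shift G)
        ≈⟨ +-cong (-‿Σ (λ r → sgnPow (toℕ r) * P r)) (*-distribˡ-Σ (sgnPow k) (λ r → sgnPow (toℕ r) * Q r)) ⟩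
      Σ (λ r → - (sgnPow (toℕ r) * P r)) + Σ (λ r → sgnPow k * (sgnPow (toℕ r) * Q r))
        ≈⟨ Σ-+ (λ r → - (sgnPow (toℕ r) * P r)) (λ r → sgnPow k * (sgnPow (toℕ r) * Q r)) ⟨
      Σ (λ r → - (sgnPow (toℕ r) * P r) + sgnPow k * (sgnPow (toℕ r) * Q r))
        ≈⟨ Σ-cong (λ r → begin
             - (sgnPow (toℕ r) * P r) + sgnPow k * (sgnPow (toℕ r) * Q r)
               ≈⟨ +-congˡ (*-CS.x∙yz≈y∙xz _ _ _) ⟩
             - (sgnPow (toℕ r) * P r) + sgnPow (toℕ r) * (sgnPow k * Q r)
               ≈⟨ -x*[y-z]≈-xy+xz _ _ _ ⟨
             - sgnPow (toℕ r) * (P r - sgnPow k * Q r)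
               ≈⟨ *-cong (sym (sgnPow-suc (toℕ r))) (sym (cofactors r)) ⟩
             sgnPow (suc (toℕ r)) * Σˡ S (λ w → sgn w * G (suc r) (Vec.map (punchIn (suc r)) w)) ∎) ⟩
      Σ (λ r → sgnPow (suc (toℕ r)) * Σˡ S (λ w → sgn w * G (suc r) (Vec.map (punchIn (suc r)) w))) ∎

  minor : ∀ {a} {A : Set a} {n k} → Fin (suc n) → Matrix A (suc n) (suc k) → Matrix A n k
  minor r M a b = M (punchIn r a) (suc b)

  det-cong : ∀ k {M N : Matrix Carrier k k} → (∀ i j → M i j ≈ N i j) → det k M ≈ det k N
  det-cong zero    M≈N = refl
  det-cong (suc k) M≈N =
    Σ-cong λ i → *-cong (*-congˡ {sgnPow (toℕ i)} (M≈N i zero)) (det-cong k (λ a b → M≈N (punchIn i a) (suc b)))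

  detC-laplace : ∀ n k (M : Matrix Carrier (suc n) (suc k)) →
                 detC (suc n) (suc k) M ≈ Σ λ r → (sgnPow (toℕ r) * M r zero) * detC n k (minor r M)
  detC-laplace n k M = begin
    detC (suc n) (suc k) M
      ≈⟨ Σˡ-cong (subsets (suc n) (suc k)) (λ c → *-congˡ (det≈expansion c)) ⟩
    subsetExpansion (suc n) k G
      ≈⟨ subsetExpansion≈rowExpansion n k G ⟩
    rowExpansion n k G
      ≈⟨ Σ-cong (λ r → trans (*-congˡ {sgnPow (toℕ r)} (cofactorSum r)) (sym (*-assoc _ _ _))) ⟩
    (Σ λ r → (sgnPow (toℕ r) * M r zero) * detC n k (minor r M)) ∎
    where
    G : Fin (suc n) → Vec (Fin (suc n)) k → Carrier
    G r w = M r zero * det k (rows (λ i j → M i (suc j)) w)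

    det≈expansion : ∀ c → det (suc k) (rows M c) ≈ expansion G c
    det≈expansion c = Σ-cong λ i → trans (*-assoc _ _ _) (*-congˡ {sgnPow (toℕ i)} (*-congˡ {M (lookup c i) zero}
      (det-cong k λ a b → reflexive (≡.cong (λ x → M x (suc b)) (≡.sym (lookup-removeAt c i a))))))

    cofactorSum : ∀ r → Σˡ (subsets n k) (λ w → sgn w * G r (Vec.map (punchIn r) w)) ≈ M r zero * detC n k (minor r M)
    cofactorSum r = trans
      (Σˡ-cong (subsets n k) λ w → trans (*-CS.x∙yz≈y∙xz _ _ _) (*-congˡ {M r zero} (*-congˡ {sgn w}
        (det-cong k λ a b → reflexive (≡.cong (λ x → M x (suc b)) (Vec.lookup-map a (punchIn r) w))))))
      (sym (*-distribˡ-Σˡ _ (subsets n k) _))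

  detCᴸ : ∀ n k → Matrix Carrier n k → Carrier
  detCᴸ n       zero    M = 1#
  detCᴸ zero    (suc k) M = 0#
  detCᴸ (suc n) (suc k) M = Σ λ r → (sgnPow (toℕ r) * M r zero) * detCᴸ n k (minor r M)

  detCᴸ-cong : ∀ n k {M N : Matrix Carrier n k} → (∀ i j → M i j ≈ N i j) → detCᴸ n k M ≈ detCᴸ n k N
  detCᴸ-cong n       zero    M≈N = refl
  detCᴸ-cong zero    (suc k) M≈N = refl
  detCᴸ-cong (suc n) (suc k) M≈N =
    Σ-cong λ r → *-cong (*-congˡ {sgnPow (toℕ r)} (M≈N r zero)) (detCᴸ-cong n k (λ a b → M≈N (punchIn r a) (suc b)))

  detC≈detCᴸ : ∀ n k (M : Matrix Carrier n k) → detC n k M ≈ detCᴸ n k M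
  detC≈detCᴸ n       zero    M = trans (+-identityʳ _) (*-identityˡ _)
  detC≈detCᴸ zero    (suc k) M = refl
  detC≈detCᴸ (suc n) (suc k) M =
    trans (detC-laplace n k M) (Σ-cong λ r → *-congˡ {sgnPow (toℕ r) * M r zero} (detC≈detCᴸ n k (minor r M)))

  detCᴸ-zeroColumn : ∀ N m (M : Matrix Carrier N m) j → (∀ i → M i j ≈ 0#) → detCᴸ N m M ≈ 0#
  detCᴸ-zeroColumn zero    (suc m) M j       M≈0 = refl
  detCᴸ-zeroColumn (suc N) (suc m) M zero    M≈0 = Σ-zero λ r →
    trans (*-congʳ {detCᴸ N m (minor r M)} (trans (*-congˡ {sgnPow (toℕ r)} (M≈0 r)) (zeroʳ _))) (zeroˡ _)
  detCᴸ-zeroColumn (suc N) (suc m) M (suc j) M≈0 = Σ-zero λ r →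
    trans (*-congˡ {sgnPow (toℕ r) * M r zero} (detCᴸ-zeroColumn N m (minor r M) j (λ a → M≈0 (punchIn r a)))) (zeroʳ _)

  -- The matrix B

  diagonalFrom : ∀ {N m} → ℕ → Carrier → Matrix Carrier N m
  diagonalFrom q x i j = when (does (toℕ i ℕ.≟ q ℕ.+ toℕ j)) x

  removeRow : ∀ {a} {A : Set a} {N m} → Fin (suc N) → Matrix A (suc N) m → Matrix A N m
  removeRow r M a = M (punchIn r a)

  removeRow-diagonalFrom : ∀ {N m q} x (r : Fin (suc N)) → toℕ r ≤ q → ∀ a (b : Fin m) →
                           removeRow r (diagonalFrom (suc q) x) a b ≡ diagonalFrom q x a b
  removeRow-diagonalFrom {q = q} x r r≤q a b =
    ≡.cong (λ e → when e x) (does-⇔ (punchIn≡suc⇔ r a (ℕ.≤-trans r≤q (ℕ.m≤m+n q (toℕ b))))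
                                     (toℕ (punchIn r a) ℕ.≟ suc q ℕ.+ toℕ b) (toℕ a ℕ.≟ q ℕ.+ toℕ b))

  minor-diagonalFrom : ∀ {N m q} x (p : Fin (suc N)) → toℕ p ≡ q → ∀ a (b : Fin m) →
                       minor p (diagonalFrom q x) a b ≡ diagonalFrom q x a b
  minor-diagonalFrom {q = q} x p ≡.refl a b =
    ≡.cong (λ e → when e x) (does-⇔ (≡.subst (λ t → toℕ (punchIn p a) ≡ t ⇔ toℕ a ≡ q ℕ.+ toℕ b)
                                              (≡.sym (ℕ.+-suc q (toℕ b)))
                                              (punchIn≡suc⇔ p a (ℕ.m≤m+n q (toℕ b))))
                                     (toℕ (punchIn p a) ℕ.≟ q ℕ.+ suc (toℕ b)) (toℕ a ℕ.≟ q ℕ.+ toℕ b))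

  detCᴸ-diagonalFrom : ∀ {N} q m → q ℕ.+ m ≡ N → detCᴸ N m (diagonalFrom q (sgnPow q)) ≈ 1#
  detCᴸ-diagonalFrom         q zero    _  = refl
  detCᴸ-diagonalFrom {zero}  q (suc m) eq = contradiction (≡.trans (≡.sym (ℕ.+-suc q m)) eq) λ ()
  detCᴸ-diagonalFrom {suc N} q (suc m) eq = begin
    Σ (λ i → (sgnPow (toℕ i) * D i zero) * detCᴸ N m (minor i D))
      ≈⟨ Σ-single (λ i → (sgnPow (toℕ i) * D i zero) * detCᴸ N m (minor i D)) p offDiagonal ⟩
    (sgnPow (toℕ p) * D p zero) * detCᴸ N m (minor p D)
      ≈⟨ *-cong (*-cong (reflexive (≡.cong sgnPow toℕp)) (reflexive (when-holds (toℕ p ℕ.≟ q ℕ.+ 0) toℕp≡q+0 _)))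
                (detCᴸ-cong N m (λ a b → reflexive (minor-diagonalFrom _ p toℕp a b))) ⟩
    (sgnPow q * sgnPow q) * detCᴸ N m (diagonalFrom q (sgnPow q))
      ≈⟨ *-cong (sgnPow-square q) (detCᴸ-diagonalFrom q m (ℕ.suc-injective (≡.trans (≡.sym (ℕ.+-suc q m)) eq))) ⟩
    1# * 1#
      ≈⟨ *-identityˡ 1# ⟩
    1# ∎
    where
    D : Matrix Carrier (suc N) (suc m)
    D = diagonalFrom q (sgnPow q)
    q<1+N : q < suc N
    q<1+N = ≡.subst (q <_) eq (ℕ.m<m+n q (s≤s z≤n))
    p : Fin (suc N)
    p = Fin.fromℕ< q<1+N
    toℕp : toℕ p ≡ q
    toℕp = Fin.toℕ-fromℕ< q<1+N
    toℕp≡q+0 : toℕ p ≡ q ℕ.+ 0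
    toℕp≡q+0 = ≡.trans toℕp (≡.sym (ℕ.+-identityʳ q))
    offDiagonal : ∀ i → i ≢ p → (sgnPow (toℕ i) * D i zero) * detCᴸ N m (minor i D) ≈ 0#
    offDiagonal i i≢p = trans (*-congʳ (trans (*-congˡ (reflexive (when-fails (toℕ i ℕ.≟ q ℕ.+ 0) i≉p _))) (zeroʳ _)))
                              (zeroˡ _)
      where
      i≉p : toℕ i ≢ q ℕ.+ 0
      i≉p e = i≢p (Fin.toℕ-injective (≡.trans e (≡.sym toℕp≡q+0)))

  detCᴸ-diagonalFrom-avoiding : ∀ {N N′ m q} x (r : Fin N) (f : Fin N′ → Fin N) → (∀ a → f a ≢ r) →
                                q ≤ toℕ r → toℕ r < q ℕ.+ m → detCᴸ N′ m (λ a → diagonalFrom q x (f a)) ≈ 0#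
  detCᴸ-diagonalFrom-avoiding {N′ = N′} {m} {q} x r f f≢r q≤r r<q+m = detCᴸ-zeroColumn N′ m _ j λ a →
    reflexive (when-fails (toℕ (f a) ℕ.≟ q ℕ.+ toℕ j) (λ e → f≢r a (Fin.toℕ-injective (≡.trans e q+j≡r))) x)
    where
    r∸q<m : toℕ r ∸ q < m
    r∸q<m = ℕ.+-cancelˡ-< q _ _ (≡.subst (_< q ℕ.+ m) (≡.sym (ℕ.m+[n∸m]≡n q≤r)) r<q+m)
    j : Fin m
    j = Fin.fromℕ< r∸q<m
    q+j≡r : q ℕ.+ toℕ j ≡ toℕ r
    q+j≡r = ≡.trans (≡.cong (q ℕ.+_) (Fin.toℕ-fromℕ< r∸q<m)) (ℕ.m+[n∸m]≡n q≤r)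

  detCᴸ-removeTwoRows-diagonalFrom : ∀ q m (r : Fin (2 ℕ.+ (q ℕ.+ m))) s →
    detCᴸ (q ℕ.+ m) m (removeRow s (removeRow r (diagonalFrom (2 ℕ.+ q) (sgnPow q))))
      ≈ when (does (toℕ r ℕ.<? 2 ℕ.+ q)) (when (does (toℕ (punchIn r s) ℕ.<? 2 ℕ.+ q)) 1#)
  detCᴸ-removeTwoRows-diagonalFrom q m r s = firstRemoval (toℕ r ℕ.<? 2 ℕ.+ q)
    where
    firstRemoval : (r<? : Dec (toℕ r < 2 ℕ.+ q)) →
                   detCᴸ (q ℕ.+ m) m (removeRow s (removeRow r (diagonalFrom (2 ℕ.+ q) (sgnPow q))))
                     ≈ when (does r<?) (when (does (toℕ (punchIn r s) ℕ.<? 2 ℕ.+ q)) 1#)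
    firstRemoval (no r≮) =
      detCᴸ-diagonalFrom-avoiding _ r (punchIn r ∘ punchIn s) (λ a → Fin.punchInᵢ≢i r _) (ℕ.≮⇒≥ r≮) (Fin.toℕ<n r)
    firstRemoval (yes r<) =
      trans (detCᴸ-cong _ m λ a b → reflexive (removeRow-diagonalFrom _ r (ℕ.≤-pred r<) (punchIn s a) b))
            (secondRemoval (toℕ (punchIn r s) ℕ.<? 2 ℕ.+ q))
      where
      s<1+q⇔ : toℕ (punchIn r s) < 2 ℕ.+ q ⇔ toℕ s < suc q
      s<1+q⇔ = punchIn<suc⇔ r s (ℕ.≤-pred r<)
      secondRemoval : (s<? : Dec (toℕ (punchIn r s) < 2 ℕ.+ q)) →
                      detCᴸ (q ℕ.+ m) m (removeRow s (diagonalFrom (suc q) (sgnPow q))) ≈ when (does s<?) 1#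
      secondRemoval (no s≮) = detCᴸ-diagonalFrom-avoiding _ s (punchIn s) (Fin.punchInᵢ≢i s)
                                (ℕ.≮⇒≥ (s≮ ∘ Equivalence.from s<1+q⇔)) (Fin.toℕ<n s)
      secondRemoval (yes s<) =
        trans (detCᴸ-cong _ m λ a b → reflexive (removeRow-diagonalFrom _ s (ℕ.≤-pred (Equivalence.to s<1+q⇔ s<)) a b))
              (detCᴸ-diagonalFrom q m ≡.refl)

  topRows : ∀ {N m} → ℕ → Matrix Carrier N m → Matrix Carrier N m
  topRows q X i j = when (does (toℕ i ℕ.<? q)) (X i j)

  detCᴸ-∣-diagonalFrom : ∀ q m (X : Matrix Carrier (2 ℕ.+ (q ℕ.+ m)) 2) →
    detCᴸ (2 ℕ.+ (q ℕ.+ m)) (2 ℕ.+ m) (X ∣ diagonalFrom (2 ℕ.+ q) (sgnPow q))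
      ≈ detCᴸ (2 ℕ.+ (q ℕ.+ m)) 2 (topRows (2 ℕ.+ q) X)
  detCᴸ-∣-diagonalFrom q m X = Σ-cong λ r → trans
    (*-congˡ {sgnPow (toℕ r) * X r zero} (Σ-cong λ s →
      *-congˡ {sgnPow (toℕ s) * X (punchIn r s) (suc zero)} (detCᴸ-removeTwoRows-diagonalFrom q m r s)))
    (factor (does (toℕ r ℕ.<? 2 ℕ.+ q)) (λ s → does (toℕ (punchIn r s) ℕ.<? 2 ℕ.+ q))
            (sgnPow (toℕ r)) (X r zero) (λ s → sgnPow (toℕ s)) (λ s → X (punchIn r s) (suc zero)))
    where
    factor : ∀ {n} a (b : Fin n → Bool) u x (v y : Fin n → Carrier) →
             (u * x) * Σ (λ s → (v s * y s) * when a (when (b s) 1#))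
               ≈ (u * when a x) * Σ (λ s → (v s * when (b s) (y s)) * 1#)
    factor true  b u x v y = *-congˡ (Σ-cong λ s → termwise (b s) (v s) (y s))
      where
      termwise : ∀ b v y → (v * y) * when b 1# ≈ (v * when b y) * 1#
      termwise true  v y = refl
      termwise false v y = trans (zeroʳ _) (sym (trans (*-identityʳ _) (zeroʳ v)))
    factor false b u x v y = begin
      (u * x) * Σ (λ s → (v s * y s) * 0#)                  ≈⟨ *-congˡ (Σ-zero λ s → zeroʳ (v s * y s)) ⟩
      (u * x) * 0#                                           ≈⟨ zeroʳ _ ⟩
      0#                                                     ≈⟨ zeroˡ _ ⟨
      0# * Σ (λ s → (v s * when (b s) (y s)) * 1#)          ≈⟨ *-congʳ (zeroʳ u) ⟨
      (u * 0#) * Σ (λ s → (v s * when (b s) (y s)) * 1#)    ∎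

  -- Cullis determinants of n × 2 matrices

  alternatingSum : ∀ {N} → (Fin N → Carrier) → Carrier
  alternatingSum f = Σ λ i → sgnPow (toℕ i) * f i

  alternatingSum-suc : ∀ {N} (f : Fin (suc N) → Carrier) → alternatingSum f ≈ f zero - alternatingSum (f ∘ suc)
  alternatingSum-suc f = +-cong (*-identityˡ _) (begin
    Σ (λ i → sgnPow (suc (toℕ i)) * f (suc i))
      ≈⟨ Σ-cong (λ i → trans (*-congʳ (sgnPow-suc (toℕ i))) (sym (-‿distribˡ-* (sgnPow (toℕ i)) (f (suc i))))) ⟩
    Σ (λ i → - (sgnPow (toℕ i) * f (suc i)))
      ≈⟨ -‿Σ (λ i → sgnPow (toℕ i) * f (suc i)) ⟨
    - alternatingSum (f ∘ suc) ∎)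

  detCᴸ-one-column : ∀ N (Z : Matrix Carrier N 1) → detCᴸ N 1 Z ≈ alternatingSum (λ i → Z i zero)
  detCᴸ-one-column zero    Z = refl
  detCᴸ-one-column (suc N) Z = Σ-cong λ i → *-identityʳ (sgnPow (toℕ i) * Z i zero)

  detCᴸ-two-columns-suc : ∀ N (Y : Matrix Carrier (suc N) 2) →
    detCᴸ (suc N) 2 Y ≈ det2 (Y zero 0F) (Y zero 1F) (alternatingSum (λ i → Y (suc i) 0F)) (alternatingSum (λ i → Y (suc i) 1F))
                        + detCᴸ N 2 (Y ∘ suc)
  detCᴸ-two-columns-suc zero    Y = +-congʳ (trans (zeroʳ _) (sym (det2-zero (Y zero 0F) (Y zero 1F))))
  detCᴸ-two-columns-suc (suc N) Y = begin
    (1# * Y zero 0F) * detCᴸ (suc N) 1 (minor zero Y)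
      + Σ (λ r → (sgnPow (suc (toℕ r)) * Y′ r 0F) * detCᴸ (suc N) 1 (minor (suc r) Y))
      ≈⟨ +-cong (*-cong (*-identityˡ _) (detCᴸ-one-column (suc N) (minor zero Y))) (Σ-cong laterRow) ⟩
    Y zero 0F * c₁ + Σ (λ r → - (a r * Y zero 1F) + a r * detCᴸ N 1 (minor r Y′))
      ≈⟨ +-congˡ (Σ-+ (λ r → - (a r * Y zero 1F)) (λ r → a r * detCᴸ N 1 (minor r Y′))) ⟩
    Y zero 0F * c₁ + (Σ (λ r → - (a r * Y zero 1F)) + detCᴸ (suc N) 2 Y′)
      ≈⟨ +-assoc _ _ _ ⟨
    (Y zero 0F * c₁ + Σ (λ r → - (a r * Y zero 1F))) + detCᴸ (suc N) 2 Y′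
      ≈⟨ +-congʳ (+-congˡ (begin
           Σ (λ r → - (a r * Y zero 1F))   ≈⟨ -‿Σ (λ r → a r * Y zero 1F) ⟨
           - Σ (λ r → a r * Y zero 1F)     ≈⟨ -‿cong (Σ-cong (λ r → *-comm (a r) (Y zero 1F))) ⟩
           - Σ (λ r → Y zero 1F * a r)     ≈⟨ -‿cong (*-distribˡ-Σ (Y zero 1F) a) ⟨
           - (Y zero 1F * c₀)              ∎)) ⟩
    det2 (Y zero 0F) (Y zero 1F) c₀ c₁ + detCᴸ (suc N) 2 Y′ ∎
    where
    Y′ : Matrix Carrier (suc N) 2
    Y′ = Y ∘ suc
    a : Fin (suc N) → Carrier
    a r = sgnPow (toℕ r) * Y′ r 0F
    c₀ c₁ : Carrier
    c₀ = alternatingSum (λ i → Y′ i 0F)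
    c₁ = alternatingSum (λ i → Y′ i 1F)
    laterRow : ∀ r → (sgnPow (suc (toℕ r)) * Y′ r 0F) * detCᴸ (suc N) 1 (minor (suc r) Y)
                       ≈ - (a r * Y zero 1F) + a r * detCᴸ N 1 (minor r Y′)
    laterRow r = begin
      (sgnPow (suc (toℕ r)) * Y′ r 0F) * detCᴸ (suc N) 1 (minor (suc r) Y)
        ≈⟨ *-cong (trans (*-congʳ (sgnPow-suc (toℕ r))) (sym (-‿distribˡ-* _ _)))
                  (detCᴸ-one-column (suc N) (minor (suc r) Y)) ⟩
      - a r * alternatingSum (λ i → minor (suc r) Y i 0F)
        ≈⟨ *-congˡ (alternatingSum-suc (λ i → minor (suc r) Y i 0F)) ⟩
      - a r * (Y zero 1F - alternatingSum (λ i → minor r Y′ i 0F))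
        ≈⟨ *-congˡ (+-congˡ (-‿cong (detCᴸ-one-column N (minor r Y′)))) ⟨
      - a r * (Y zero 1F - detCᴸ N 1 (minor r Y′))
        ≈⟨ -x*[y-z]≈-xy+xz (a r) _ _ ⟩
      - (a r * Y zero 1F) + a r * detCᴸ N 1 (minor r Y′) ∎

  minor₂ : ∀ {N} → Matrix Carrier N 2 → Fin N → Fin N → Carrier
  minor₂ Y l m = det2 (Y l 0F) (Y l 1F) (Y m 0F) (Y m 1F)

  -- The Cullis determinant of an N × 2 matrix as a sum over pairs of rows l < m; with 0-based
  -- indices the sign sgn {l , m} is (-1)^(l + m - 1).
  pairSum : ∀ {N} → Matrix Carrier N 2 → Carrier
  pairSum Y = Σ λ l → Σ λ m → when (does (toℕ l ℕ.<? toℕ m)) (sgnPow (suc (toℕ l ℕ.+ toℕ m)) * minor₂ Y l m)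

  Σ-det2 : ∀ {N} a b (s c d : Fin N → Carrier) →
           Σ (λ i → s i * det2 a b (c i) (d i)) ≈ det2 a b (Σ (λ i → s i * c i)) (Σ (λ i → s i * d i))
  Σ-det2 a b s c d = begin
    Σ (λ i → s i * det2 a b (c i) (d i))
      ≈⟨ Σ-cong (λ i → trans (x[y-z]≈xy-xz (s i) (a * d i) (b * c i))
                             (+-cong (*-CS.x∙yz≈y∙xz (s i) a (d i)) (-‿cong (*-CS.x∙yz≈y∙xz (s i) b (c i))))) ⟩
    Σ (λ i → a * (s i * d i) - b * (s i * c i))
      ≈⟨ Σ-+ (λ i → a * (s i * d i)) (λ i → - (b * (s i * c i))) ⟩
    Σ (λ i → a * (s i * d i)) + Σ (λ i → - (b * (s i * c i)))
      ≈⟨ +-cong (*-distribˡ-Σ a (λ i → s i * d i)) (-‿Σ (λ i → b * (s i * c i))) ⟨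
    a * Σ (λ i → s i * d i) - Σ (λ i → b * (s i * c i))
      ≈⟨ +-congˡ (-‿cong (*-distribˡ-Σ b (λ i → s i * c i))) ⟨
    det2 a b (Σ (λ i → s i * c i)) (Σ (λ i → s i * d i)) ∎

  pairSum-suc : ∀ {N} (Y : Matrix Carrier (suc N) 2) →
    pairSum Y ≈ det2 (Y zero 0F) (Y zero 1F) (alternatingSum (λ i → Y (suc i) 0F)) (alternatingSum (λ i → Y (suc i) 1F))
                + pairSum (Y ∘ suc)
  pairSum-suc Y = +-cong
    (trans (+-identityˡ _) (Σ-det2 (Y zero 0F) (Y zero 1F) (sgnPow ∘ toℕ) (λ i → Y (suc i) 0F) (λ i → Y (suc i) 1F)))
    (Σ-cong λ l → trans (+-identityˡ _) (Σ-cong λ m → when-cong (does (toℕ l ℕ.<? toℕ m))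
      (*-congʳ {minor₂ Y (suc l) (suc m)} (reflexive (≡.cong sgnPow (ℕ.+-suc (toℕ l) (toℕ m)))))))

  detCᴸ₂≈pairSum : ∀ N (Y : Matrix Carrier N 2) → detCᴸ N 2 Y ≈ pairSum Y
  detCᴸ₂≈pairSum zero    Y = refl
  detCᴸ₂≈pairSum (suc N) Y =
    trans (detCᴸ-two-columns-suc N Y) (trans (+-congˡ (detCᴸ₂≈pairSum N (Y ∘ suc))) (sym (pairSum-suc Y)))

  pairSumUpTo : ∀ {N} → ℕ → Matrix Carrier N 2 → Carrier
  pairSumUpTo q X = Σ λ l → Σ λ m → when (does (toℕ l ℕ.<? toℕ m) ∧ does (toℕ m ℕ.<? q))
                                         (sgnPow (suc (toℕ l ℕ.+ toℕ m)) * minor₂ X l m)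

  pairSum-topRows : ∀ {N} q (X : Matrix Carrier N 2) → pairSum (topRows q X) ≈ pairSumUpTo q X
  pairSum-topRows q X = Σ-cong λ l → Σ-cong λ m → pairTerm l m (toℕ l ℕ.<? toℕ m) (toℕ m ℕ.<? q)
    where
    pairTerm : ∀ l m (l<m? : Dec (toℕ l < toℕ m)) (m<q? : Dec (toℕ m < q)) →
      when (does l<m?) (sgnPow (suc (toℕ l ℕ.+ toℕ m))
                          * det2 (topRows q X l 0F) (topRows q X l 1F) (when (does m<q?) (X m 0F)) (when (does m<q?) (X m 1F)))
        ≈ when (does l<m? ∧ does m<q?) (sgnPow (suc (toℕ l ℕ.+ toℕ m)) * minor₂ X l m)
    pairTerm l m (no _)    _         = refl
    pairTerm l m (yes _)   (no _)    = trans (*-congˡ (det2-zero _ _)) (zeroʳ _)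
    pairTerm l m (yes l<m) (yes m<q) = *-congˡ (reflexive (≡.cong₂ (λ a b → det2 a b (X m 0F) (X m 1F))
                                                   (when-holds (toℕ l ℕ.<? q) l<q _) (when-holds (toℕ l ℕ.<? q) l<q _)))
      where
      l<q : toℕ l < q
      l<q = ℕ.<-trans l<m m<q

  rhs≈pairSumUpTo : ∀ N k (X : Matrix Carrier (2 ℕ.+ N) 2) →
                    rhs (2 ℕ.+ N) k X zero (suc zero) ≈ pairSumUpTo ((2 ℕ.+ N ∸ k) ℕ.+ 2) X
  rhs≈pairSumUpTo N k X = begin
    rhs (2 ℕ.+ N) k X zero (suc zero)
      ≈⟨ +-cong (+-cong firstPair (trans (+-identityˡ _) (trans (+-identityˡ _) headPairs))) laterPairs ⟩
    (P₀₁ + (R₀ + R₁)) + Rₗ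
      ≈⟨ regroup P₀₁ R₀ R₁ Rₗ ⟩
    pairSumUpTo u X ∎
    where
    u : ℕ
    u = (2 ℕ.+ N ∸ k) ℕ.+ 2
    X′ : Matrix Carrier N 2
    X′ i = X (suc (suc i))
    b : Fin N → Bool
    b j = does (2 ℕ.+ toℕ j ℕ.<? u)
    P₀₁ R₀ R₁ Rₗ : Carrier
    P₀₁ = when (does (1 ℕ.<? u)) (sgnPow 2 * minor₂ X 0F 1F)
    R₀ = Σ λ j → when (b j) (sgnPow (suc (toℕ j)) * minor₂ X 0F (suc (suc j)))
    R₁ = Σ λ j → when (b j) (sgnPow (toℕ j) * minor₂ X 1F (suc (suc j)))
    Rₗ = Σ λ i → 0# + (0# + Σ λ j → when (does (toℕ i ℕ.<? toℕ j) ∧ b j)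
                                          (sgnPow (suc (toℕ i ℕ.+ (2 ℕ.+ toℕ j))) * minor₂ X′ i j))

    firstPair : minor₂ X 0F 1F ≈ P₀₁
    firstPair = sym (trans (reflexive (when-holds (1 ℕ.<? u) (ℕ.m≤n+m 2 _) _)) (*-identityˡ _))

    headPairs : Σ (λ j → when (b j) (sgnPow (suc (toℕ j)) * det2 (X 0F 0F - X 1F 0F) (X 0F 1F - X 1F 1F) (X′ j 0F) (X′ j 1F)))
                  ≈ R₀ + R₁
    headPairs = trans (Σ-cong λ j → trans (when-cong (b j) (split j (X′ j 0F) (X′ j 1F))) (sym (when-+ (b j) _ _)))
                      (Σ-+ (λ j → when (b j) (sgnPow (suc (toℕ j)) * minor₂ X 0F (suc (suc j))))
                           (λ j → when (b j) (sgnPow (toℕ j) * minor₂ X 1F (suc (suc j)))))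
      where
      split : ∀ j e f → sgnPow (suc (toℕ j)) * det2 (X 0F 0F - X 1F 0F) (X 0F 1F - X 1F 1F) e f
                          ≈ sgnPow (suc (toℕ j)) * det2 (X 0F 0F) (X 0F 1F) e f + sgnPow (toℕ j) * det2 (X 1F 0F) (X 1F 1F) e f
      split j e f = begin
        sgnPow (suc (toℕ j)) * det2 (X 0F 0F - X 1F 0F) (X 0F 1F - X 1F 1F) e f
          ≈⟨ *-cong (sgnPow-suc (toℕ j)) (det2-sub _ _ _ _ e f) ⟩
        - sgnPow (toℕ j) * (det2 (X 0F 0F) (X 0F 1F) e f - det2 (X 1F 0F) (X 1F 1F) e f)
          ≈⟨ -x*[y-z]≈-xy+xz (sgnPow (toℕ j)) _ _ ⟩
        - (sgnPow (toℕ j) * det2 (X 0F 0F) (X 0F 1F) e f) + sgnPow (toℕ j) * det2 (X 1F 0F) (X 1F 1F) e f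
          ≈⟨ +-congʳ (trans (-‿distribˡ-* _ _) (*-congʳ (sym (sgnPow-suc (toℕ j))))) ⟩
        sgnPow (suc (toℕ j)) * det2 (X 0F 0F) (X 0F 1F) e f + sgnPow (toℕ j) * det2 (X 1F 0F) (X 1F 1F) e f ∎

    inRange : ℕ → Bool
    inRange l = (3 ℕ.≤ᵇ l) ∧ (l ℕ.≤ᵇ u)

    condition : ∀ (i j : Fin N) (j<u? : Dec (2 ℕ.+ toℕ j < u)) (i<j? : Dec (toℕ i < toℕ j)) →
                (b i ∧ (does j<u? ∧ does i<j?)) ≡ (does i<j? ∧ does j<u?)
    condition i j (yes j<u) (yes i<j) = ≡.cong (_∧ true) (dec-true (2 ℕ.+ toℕ i ℕ.<? u) (ℕ.<-trans (s≤s (s≤s i<j)) j<u))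
    condition i j (yes _)   (no _)    = ∧-zeroʳ (b i)
    condition i j (no _)    (yes _)   = ∧-zeroʳ (b i)
    condition i j (no _)    (no _)    = ∧-zeroʳ (b i)

    laterPairs : Σ (λ l → Σ (λ m →
                   when (inRange (suc (toℕ l)) ∧ inRange (suc (toℕ m)) ∧ (suc (toℕ l) ℕ.<ᵇ suc (toℕ m)))
                        (sgnPow (suc (toℕ l) ℕ.+ suc (toℕ m) ∸ 3) * minor₂ X l m)))
                   ≈ Rₗ
    laterPairs = trans (+-cong (Σ-zero {2 ℕ.+ N} {λ _ → 0#} λ _ → refl) (+-cong (Σ-zero {2 ℕ.+ N} {λ _ → 0#} λ _ → refl)
                         (Σ-cong λ i → +-cong (notLater i) (+-cong (notLater i) (Σ-cong λ j → later i j)))))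
                       (trans (+-identityˡ _) (+-identityˡ _))
      where
      notLater : ∀ i {x} → when (b i ∧ false) x ≈ 0#
      notLater i = reflexive (≡.cong (λ c → when c _) (∧-zeroʳ (b i)))
      later : ∀ i j →
        when (b i ∧ (b j ∧ does (toℕ i ℕ.<? toℕ j))) (sgnPow (toℕ i ℕ.+ (3 ℕ.+ toℕ j)) * minor₂ X′ i j)
          ≈ when (does (toℕ i ℕ.<? toℕ j) ∧ b j) (sgnPow (suc (toℕ i ℕ.+ (2 ℕ.+ toℕ j))) * minor₂ X′ i j)
      later i j = reflexive (≡.cong₂ when (condition i j (2 ℕ.+ toℕ j ℕ.<? u) (toℕ i ℕ.<? toℕ j))
                                          (≡.cong (λ e → sgnPow e * minor₂ X′ i j) (ℕ.+-suc (toℕ i) (2 ℕ.+ toℕ j))))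

    regroup : ∀ a b c d → (a + (b + c)) + d ≈ (0# + (a + b)) + ((0# + (0# + c)) + d)
    regroup a b c d = begin
      (a + (b + c)) + d                     ≈⟨ +-congʳ (+-assoc a b c) ⟨
      ((a + b) + c) + d                     ≈⟨ +-assoc _ c d ⟩
      (a + b) + (c + d)                     ≈⟨ +-cong (+-identityˡ _) (+-congʳ (trans (+-identityˡ _) (+-identityˡ c))) ⟨
      (0# + (a + b)) + ((0# + (0# + c)) + d) ∎

  detC-∣-diagonalFrom≈rhs : ∀ {N} q m → q ℕ.+ m ≡ N → (X : Matrix Carrier (2 ℕ.+ N) 2) →
    detC (2 ℕ.+ N) (2 ℕ.+ m) (X ∣ diagonalFrom (2 ℕ.+ q) (sgnPow q)) ≈ rhs (2 ℕ.+ N) (2 ℕ.+ m) X zero (suc zero)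
  detC-∣-diagonalFrom≈rhs q m ≡.refl X = begin
    detC (2 ℕ.+ (q ℕ.+ m)) (2 ℕ.+ m) (X ∣ diagonalFrom (2 ℕ.+ q) (sgnPow q))
      ≈⟨ detC≈detCᴸ (2 ℕ.+ (q ℕ.+ m)) (2 ℕ.+ m) (X ∣ diagonalFrom (2 ℕ.+ q) (sgnPow q)) ⟩
    detCᴸ (2 ℕ.+ (q ℕ.+ m)) (2 ℕ.+ m) (X ∣ diagonalFrom (2 ℕ.+ q) (sgnPow q))
      ≈⟨ detCᴸ-∣-diagonalFrom q m X ⟩
    detCᴸ (2 ℕ.+ (q ℕ.+ m)) 2 (topRows (2 ℕ.+ q) X)
      ≈⟨ detCᴸ₂≈pairSum (2 ℕ.+ (q ℕ.+ m)) (topRows (2 ℕ.+ q) X) ⟩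
    pairSum (topRows (2 ℕ.+ q) X)
      ≈⟨ pairSum-topRows (2 ℕ.+ q) X ⟩
    pairSumUpTo (2 ℕ.+ q) X
      ≡⟨ ≡.cong (λ u → pairSumUpTo u X) (≡.trans (ℕ.+-comm 2 q) (≡.cong (ℕ._+ 2) (≡.sym (ℕ.m+n∸n≡m q m)))) ⟩
    pairSumUpTo ((2 ℕ.+ (q ℕ.+ m) ∸ (2 ℕ.+ m)) ℕ.+ 2) X
      ≈⟨ rhs≈pairSumUpTo (q ℕ.+ m) (2 ℕ.+ m) X ⟨
    rhs (2 ℕ.+ (q ℕ.+ m)) (2 ℕ.+ m) X zero (suc zero) ∎

lemma17 : ∀ {c ℓ} (F : Field c ℓ) (n k : ℕ) (2≤k : 2 ≤ k) (k≤n : k ≤ n)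
          (X : Matrix (Field.Carrier F) n 2) →
          ∃ λ (B : Matrix (Field.Carrier F) n (k ∸ 2)) →
            Field._≈_ F
              (Cullis.detC (Field.commutativeRing F) n (2 ℕ.+ (k ∸ 2)) (Cullis._∣_ (Field.commutativeRing F) X B))
              (Cullis.rhs (Field.commutativeRing F) n k X (fromℕ< (≤-trans (s≤s z≤n) (≤-trans 2≤k k≤n))) (fromℕ< (≤-trans 2≤k k≤n)))
lemma17 F (suc (suc n)) (suc (suc m)) (s≤s (s≤s z≤n)) (s≤s (s≤s m≤n)) X =
  diagonalFrom (2 ℕ.+ q) (sgnPow q) , detC-∣-diagonalFrom≈rhs q m (ℕ.m∸n+n≡m m≤n) X
  where
  open Cullis (Field.commutativeRing F) using (sgnPow)
  open CullisProperties (Field.commutativeRing F)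
  q : ℕ
  q = n ∸ m
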